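{- Let $\varphi$ be a coloring on a finite or countable set $X$ and let $a,b$ be two distinct points not in $X$. Then there is a coloring $\psi$ on $X\cup\{a,b\}$ such that $\psi|X=\varphi$ and $\psi$ is reconstructible.
   Context: A coloring on a set $X$ is a function $\varphi:[X]^2\to\{0,1\}$, where $[X]^2$ is the set of $2$-element subsets of $X$; $\psi|X$ denotes the restriction to $[X]^2$. $\mathrm{hom}(\varphi)=\{H\subseteq X:\ |H|>2 \text{ and } \varphi \text{ is constant on } [H]^2\}$. A coloring $\varphi$ on $X$ is reconstructible if for every coloring $\psi$ on $X$ with $\mathrm{hom}(\psi)=\mathrm{hom}(\varphi)$ one has $\psi=\varphi$ or $\psi=1-\varphi$. -}

module Defs where

open import Data.Bool using (Bool; true; false; not)
open import Data.Nat using (ℕ)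
open import Data.Sum using (_⊎_; inj₁; inj₂)
open import Data.Product using (Σ; ∃; _×_; _,_)
open import Relation.Binary.PropositionalEquality using (_≡_; _≢_)
open import Function.Definitions using (Injective)

-- A coloring on X : a function on 2-element subsets {x,y} of X.
-- Represented as a symmetric function X → X → Bool; only its values on
-- pairs of DISTINCT points are meaningful (diagonal values are ignored
-- by every notion below).
record Coloring (X : Set) : Set where
  field
    col : X → X → Bool
    sym : ∀ x y → col x y ≡ col y x
open Coloring public

_≈c_ : {X : Set} → Coloring X → Coloring X → Set
_≈c_ {X} φ ψ = ∀ (x y : X) → x ≢ y → col φ x y ≡ col ψ x y

compl : {X : Set} → Coloring X → Coloring X
compl φ = record { col = λ x y → not (col φ x y)
                 ; sym = λ x y → helper (col φ x y) (col φ y x) (sym φ x y) }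
  where
  helper : ∀ a b → a ≡ b → not a ≡ not b
  helper a .a _≡_.refl = _≡_.refl

MoreThanTwo : {X : Set} → (X → Set) → Set
MoreThanTwo {X} H = Σ X λ x → Σ X λ y → Σ X λ z →
  H x × H y × H z × x ≢ y × x ≢ z × y ≢ z

ConstantOn : {X : Set} → Coloring X → (X → Set) → Set
ConstantOn {X} φ H = Σ Bool λ c → ∀ (x y : X) → H x → H y → x ≢ y → col φ x y ≡ c

Hom : {X : Set} → Coloring X → (X → Set) → Set
Hom φ H = MoreThanTwo H × ConstantOn φ H

SameHom : {X : Set} → Coloring X → Coloring X → Set₁
SameHom {X} φ ψ = ∀ (H : X → Set) → (Hom φ H → Hom ψ H) × (Hom ψ H → Hom φ H)

Reconstructible : {X : Set} → Coloring X → Set₁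
Reconstructible {X} φ = ∀ (ψ : Coloring X) → SameHom ψ φ → (ψ ≈c φ) ⊎ (ψ ≈c compl φ)

Countable : Set → Set
Countable X = Σ (X → ℕ) λ f → Injective _≡_ _≡_ f

-- X ∪ {a,b} with a = inj₂ false, b = inj₂ true (two distinct new points)
Ext : Set → Set
Ext X = X ⊎ Bool

RestrictsTo : {X : Set} → Coloring (Ext X) → Coloring X → Set
RestrictsTo {X} ψ φ = ∀ (x y : X) → x ≢ y → col ψ (inj₁ x) (inj₁ y) ≡ col φ x y

-- Join the two new points a, b to everything (each other included) with colour 0. If hom(ψ') = hom(ψ),
-- the homogeneous triangles {a, b, x} force ψ' to be constant, say c, on all pairs meeting a or b.
-- Then, for x ≠ y in X, the triangle {a, x, y} is homogeneous for ψ' iff ψ'(x, y) = c, and for ψ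
-- iff ψ(x, y) = 0; so ψ' = ψ when c = 0 and ψ' = 1 - ψ when c = 1.
module Submission where

open import Defs hiding (sym)
open import Data.Bool using (Bool; true; false; not; _≟_)
open import Data.Bool.Properties using (not-involutive; ¬-not)
open import Data.Empty using (⊥-elim)
open import Data.Product using (Σ; _×_; _,_; proj₁; proj₂)
open import Data.Sum using (_⊎_; inj₁; inj₂)
open import Function.Bundles using (_⇔_; mk⇔; Equivalence)
import Function.Properties.Equivalence as ⇔
open import Level using (0ℓ)
open import Relation.Binary.PropositionalEquality using (_≡_; _≢_; refl; sym; trans; cong; ≢-sym; module ≡-Reasoning)
open import Relation.Nullary using (Dec; yes; no)
import Relation.Binary.Reasoning.Setoid

open Equivalence using (to; from)

module ⇔-Reasoning = Relation.Binary.Reasoning.Setoid (⇔.⇔-setoid 0ℓ)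

≡-of-≡-⇔-≡ : {x y k : Bool} → (x ≡ k ⇔ y ≡ k) → x ≡ y
≡-of-≡-⇔-≡ {x} {k = k} x⇔y with x ≟ k
... | yes x≡k = trans x≡k (sym (to x⇔y x≡k))
... | no x≢k = trans (¬-not x≢k) (sym (¬-not (λ y≡k → x≢k (from x⇔y y≡k))))

module _ {Y : Set} where

  Triangle : Y → Y → Y → Y → Set
  Triangle p q r z = z ≡ p ⊎ z ≡ q ⊎ z ≡ r

  Monochromatic : Coloring Y → Y → Y → Y → Set
  Monochromatic χ p q r = col χ p r ≡ col χ p q × col χ q r ≡ col χ p q

  module _ {p q r : Y} (p≢q : p ≢ q) (p≢r : p ≢ r) (q≢r : q ≢ r) where

    hom-triangle : {χ : Coloring Y} → Monochromatic χ p q r → Hom χ (Triangle p q r)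
    hom-triangle {χ} (pr≡pq , qr≡pq) =
      (p , q , r , inj₁ refl , inj₂ (inj₁ refl) , inj₂ (inj₂ refl) , p≢q , p≢r , q≢r) ,
      col χ p q , constant
      where
      constant : ∀ x y → Triangle p q r x → Triangle p q r y → x ≢ y → col χ x y ≡ col χ p q
      constant _ _ (inj₁ refl)        (inj₂ (inj₁ refl)) _ = refl
      constant _ _ (inj₁ refl)        (inj₂ (inj₂ refl)) _ = pr≡pq
      constant _ _ (inj₂ (inj₁ refl)) (inj₂ (inj₂ refl)) _ = qr≡pq
      constant _ _ (inj₂ (inj₁ refl)) (inj₁ refl)        _ = Coloring.sym χ q p
      constant _ _ (inj₂ (inj₂ refl)) (inj₁ refl)        _ = trans (Coloring.sym χ r p) pr≡pq
      constant _ _ (inj₂ (inj₂ refl)) (inj₂ (inj₁ refl)) _ = trans (Coloring.sym χ r q) qr≡pq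
      constant _ _ (inj₁ refl)        (inj₁ refl)        x≢x = ⊥-elim (x≢x refl)
      constant _ _ (inj₂ (inj₁ refl)) (inj₂ (inj₁ refl)) x≢x = ⊥-elim (x≢x refl)
      constant _ _ (inj₂ (inj₂ refl)) (inj₂ (inj₂ refl)) x≢x = ⊥-elim (x≢x refl)

    monochromatic-of-hom : {χ : Coloring Y} → Hom χ (Triangle p q r) → Monochromatic χ p q r
    monochromatic-of-hom {χ} (_ , c , constant) =
      trans pr≡c (sym pq≡c) , trans (constant q r (inj₂ (inj₁ refl)) (inj₂ (inj₂ refl)) q≢r) (sym pq≡c)
      where
      pq≡c : col χ p q ≡ c
      pq≡c = constant p q (inj₁ refl) (inj₂ (inj₁ refl)) p≢q
      pr≡c : col χ p r ≡ c
      pr≡c = constant p r (inj₁ refl) (inj₂ (inj₂ refl)) p≢r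

    sameHom-monochromatic : {ψ χ : Coloring Y} → SameHom ψ χ →
      Monochromatic ψ p q r ⇔ Monochromatic χ p q r
    sameHom-monochromatic {ψ} {χ} same = mk⇔
      (λ m → monochromatic-of-hom {χ} (proj₁ (same (Triangle p q r)) (hom-triangle {ψ} m)))
      (λ m → monochromatic-of-hom {ψ} (proj₂ (same (Triangle p q r)) (hom-triangle {χ} m)))

  monochromatic-⇔ : (χ : Coloring Y) {p q r : Y} {k : Bool} → col χ p q ≡ k → col χ p r ≡ k →
    Monochromatic χ p q r ⇔ col χ q r ≡ k
  monochromatic-⇔ _ pq≡k pr≡k = mk⇔
    (λ (_ , qr≡pq) → trans qr≡pq pq≡k)
    (λ qr≡k → trans pr≡k (sym pq≡k) , trans qr≡k (sym pq≡k))

  constantOn-compl : {χ : Coloring Y} {H : Y → Set} → ConstantOn χ H → ConstantOn (compl χ) H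
  constantOn-compl (c , constant) = not c , λ x y hx hy x≢y → cong not (constant x y hx hy x≢y)

  constantOn-of-compl : {χ : Coloring Y} {H : Y → Set} → ConstantOn (compl χ) H → ConstantOn χ H
  constantOn-of-compl {χ} (c , constant) =
    not c , λ x y hx hy x≢y → trans (sym (not-involutive (col χ x y))) (cong not (constant x y hx hy x≢y))

  sameHom-compl : {ψ χ : Coloring Y} → SameHom ψ χ → SameHom ψ (compl χ)
  sameHom-compl {χ = χ} same H =
    (λ (big , const) → big , constantOn-compl {χ} (proj₂ (proj₁ (same H) (big , const)))) ,
    (λ (big , const) → proj₂ (same H) (big , constantOn-of-compl {χ} const))

  Cone : Coloring Y → Y → Bool → Set
  Cone χ a k = ∀ v → a ≢ v → col χ a v ≡ k

  module _ {a b : Y} (a≢b : a ≢ b) (_≟a : ∀ u → Dec (u ≡ a)) (_≟b : ∀ u → Dec (u ≡ b)) where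

    cone-of-sameHom : {k : Bool} {ψ θ : Coloring Y} → SameHom ψ θ → Cone θ a k → Cone θ b k →
      col ψ a b ≡ k → Cone ψ a k
    cone-of-sameHom {ψ = ψ} {θ} same coneᵃ coneᵇ ab≡k v a≢v with v ≟b
    ... | yes refl = ab≡k
    ... | no v≢b = trans (proj₁ (from abv-ψ⇔θ abv-θ)) ab≡k
      where
      abv-ψ⇔θ : Monochromatic ψ a b v ⇔ Monochromatic θ a b v
      abv-ψ⇔θ = sameHom-monochromatic a≢b a≢v (≢-sym v≢b) {ψ} {θ} same
      abv-θ : Monochromatic θ a b v
      abv-θ = trans (coneᵃ v a≢v) (sym (coneᵃ b a≢b)) ,
              trans (coneᵇ v (≢-sym v≢b)) (sym (coneᵃ b a≢b))

    ≈c-of-sameHom-cones : {k : Bool} {ψ θ : Coloring Y} → SameHom ψ θ →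
      Cone ψ a k → Cone θ a k → ψ ≈c θ
    ≈c-of-sameHom-cones {k} {ψ} {θ} same coneψ coneθ u v u≢v with u ≟a | v ≟a
    ... | yes refl | _ = trans (coneψ v u≢v) (sym (coneθ v u≢v))
    ... | no _ | yes refl = begin
      col ψ u v ≡⟨ Coloring.sym ψ u v ⟩
      col ψ v u ≡⟨ coneψ u (≢-sym u≢v) ⟩
      k         ≡⟨ sym (coneθ u (≢-sym u≢v)) ⟩
      col θ v u ≡⟨ Coloring.sym θ v u ⟩
      col θ u v ∎
      where open ≡-Reasoning
    ... | no u≢a | no v≢a = ≡-of-≡-⇔-≡ (begin
      col ψ u v ≡ k          ≈⟨ ⇔.sym (monochromatic-⇔ ψ (coneψ u (≢-sym u≢a)) (coneψ v (≢-sym v≢a))) ⟩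
      Monochromatic ψ a u v  ≈⟨ sameHom-monochromatic (≢-sym u≢a) (≢-sym v≢a) u≢v {ψ} {θ} same ⟩
      Monochromatic θ a u v  ≈⟨ monochromatic-⇔ θ (coneθ u (≢-sym u≢a)) (coneθ v (≢-sym v≢a)) ⟩
      col θ u v ≡ k          ∎)
      where open ⇔-Reasoning

    reconstructible-of-cones : {k : Bool} {χ : Coloring Y} → Cone χ a k → Cone χ b k → Reconstructible χ
    reconstructible-of-cones {k} {χ} coneᵃ coneᵇ ψ same with col ψ a b ≟ k
    ... | yes ab≡k =
      inj₁ (≈c-of-sameHom-cones {ψ = ψ} {χ} same
              (cone-of-sameHom {ψ = ψ} {χ} same coneᵃ coneᵇ ab≡k) coneᵃ)
    ... | no ab≢k =
      inj₂ (≈c-of-sameHom-cones {ψ = ψ} {compl χ} same′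
              (cone-of-sameHom {ψ = ψ} {compl χ} same′ coneᵃ′ coneᵇ′ (¬-not ab≢k)) coneᵃ′)
      where
      same′ : SameHom ψ (compl χ)
      same′ = sameHom-compl {ψ} {χ} same
      coneᵃ′ : Cone (compl χ) a (not k)
      coneᵃ′ v a≢v = cong not (coneᵃ v a≢v)
      coneᵇ′ : Cone (compl χ) b (not k)
      coneᵇ′ v b≢v = cong not (coneᵇ v b≢v)

module _ {X : Set} where

  extendByZero : Coloring X → Coloring (Ext X)
  extendByZero φ = record { col = colour ; sym = colour-sym }
    where
    colour : Ext X → Ext X → Bool
    colour (inj₁ x) (inj₁ y) = col φ x y
    colour _ _ = false
    colour-sym : ∀ u v → colour u v ≡ colour v u
    colour-sym (inj₁ x) (inj₁ y) = Coloring.sym φ x y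
    colour-sym (inj₁ _) (inj₂ _) = refl
    colour-sym (inj₂ _) (inj₁ _) = refl
    colour-sym (inj₂ _) (inj₂ _) = refl

  ≟-new : (c : Bool) (u : Ext X) → Dec (u ≡ inj₂ c)
  ≟-new c (inj₁ _) = no λ ()
  ≟-new c (inj₂ d) with d ≟ c
  ... | yes refl = yes refl
  ... | no d≢c = no λ { refl → d≢c refl }

  cone-extendByZero : (φ : Coloring X) (c : Bool) → Cone (extendByZero φ) (inj₂ c) false
  cone-extendByZero φ c (inj₁ _) _ = refl
  cone-extendByZero φ c (inj₂ _) _ = refl

mainTheorem9 : (X : Set) → Countable X → (φ : Coloring X) →
    Σ (Coloring (Ext X)) (λ ψ → RestrictsTo ψ φ × Reconstructible ψ)
mainTheorem9 X _ φ =
  extendByZero φ ,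
  (λ _ _ _ → refl) ,
  reconstructible-of-cones (λ ()) (≟-new false) (≟-new true) {χ = extendByZero φ}
    (cone-extendByZero φ false) (cone-extendByZero φ true)
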